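{- Let $q$ be a prime power, $r\ge1$, let $(G,R)$ be a $2$-coloring of $PG(r-1,q)$ such that $PG(r-1,q)|G$ is a projective target, and let $H$ be a hyperplane of $PG(r-1,q)$. Then, regarding $PG(r-1,q)\backslash H$ as the affine geometry $AG(r-1,q)$, the matroid $PG(r-1,q)|(G-H)$ is an affine target.
   Context: $PG(r-1,q)$ and $AG(r-1,q)$ denote the rank-$r$ projective and affine geometries over $GF(q)$; deleting a projective hyperplane $H$ from $PG(r-1,q)$ gives $AG(r-1,q)$. A $2$-coloring $(G,R)$ is a partition of the ground set into possibly empty sets $G$ and $R$. For $X\subseteq E(PG(r-1,q))$, $PG(r-1,q)|X$ is a projective target if there is a sequence $(F_0,\dots,F_k)$ of possibly empty projective flats with $\emptyset=F_0\subseteq\dots\subseteq F_k=E(PG(r-1,q))$ such that $X$ is the union of the sets $F_{i+1}-F_i$ over all even $i$ with $0\le i\le k-1$. Affine targets are defined in the same way using a nested sequence of (possibly empty) affine flats ending in $E(AG(r-1,q))$. -}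

module Defs where

open import Level using (0ℓ)
import Data.Nat
open import Data.Nat using (ℕ; suc)
import Data.Fin
open import Data.Fin using (Fin)
open import Data.Sum using (_⊎_)
open import Data.Product using (Σ; ∃; _×_; _,_; proj₁)
open import Relation.Binary.PropositionalEquality using (_≡_)
open import Relation.Nullary using (¬_)
open import Function.Bundles using (_↔_; _⇔_)
open import Algebra.Structures using (IsCommutativeRing)

-- Every finite field has
-- prime-power order q, and GF(q) is the unique field of order q, so
-- quantifying over all finite fields = quantifying over all GF(q).
record FiniteField : Set₁ where
  infixl 6 _+_
  infixl 7 _*_
  field
    Carrier : Set
    _+_ _*_ : Carrier → Carrier → Carrier
    -_      : Carrier → Carrier
    0# 1#   : Carrier
    isCommutativeRing : IsCommutativeRing _≡_ _+_ _*_ -_ 0# 1#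
    0≢1     : ¬ (0# ≡ 1#)
    inverse : ∀ x → ¬ (x ≡ 0#) → Σ Carrier λ y → x * y ≡ 1#
    order   : ℕ
    finite  : Fin order ↔ Carrier

Even : ℕ → Set
Even i = Σ ℕ λ m → i ≡ m Data.Nat.+ m

module Geometry (𝔽 : FiniteField) (r : ℕ) where
  open FiniteField 𝔽

  V : Set
  V = Fin r → Carrier

  zeroV : V
  zeroV _ = 0#

  _+V_ : V → V → V
  (u +V v) i = u i + v i

  _·V_ : Carrier → V → V
  (a ·V v) i = a * v i

  Normalized : V → Set
  Normalized v = Σ (Fin r) λ i → (v i ≡ 1#) × (∀ j → j Data.Fin.< i → v j ≡ 0#)

  -- points of PG(r-1,q) (= 1-dim subspaces of F^r, via canonical representatives)
  Point : Set
  Point = Σ V Normalized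

  vec : Point → V
  vec = proj₁

  PSet : Set₁
  PSet = Point → Set

  record IsSubspace (W : V → Set) : Set where
    field
      zero∈ : W zeroV
      +∈    : ∀ {u v} → W u → W v → W (u +V v)
      ·∈    : ∀ a {v} → W v → W (a ·V v)

  IsProjFlat : PSet → Set₁
  IsProjFlat X = Σ (V → Set) λ W → IsSubspace W × (∀ p → X p ⇔ W (vec p))

  dot : V → V → Carrier
  dot a v = sumF r (λ i → a i * v i)
    where
    sumF : (n : ℕ) → (Fin n → Carrier) → Carrier
    sumF Data.Nat.zero f = 0#
    sumF (suc n) f = f Data.Fin.zero + sumF n (λ i → f (Data.Fin.suc i))

  IsHyperplane : PSet → Set
  IsHyperplane H = Σ V λ a → ¬ (∀ i → a i ≡ 0#) × (∀ p → H p ⇔ (dot a (vec p) ≡ 0#))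

  Is2Coloring : PSet → PSet → Set
  Is2Coloring G R = ∀ p → (G p × ¬ R p) ⊎ (R p × ¬ G p)

  _⊆_ : PSet → PSet → Set
  X ⊆ Y = ∀ p → X p → Y p

  IsProjTarget : PSet → Set₁
  IsProjTarget X =
    Σ ℕ λ k → Σ (ℕ → PSet) λ F →
      (∀ i → i Data.Nat.< suc k → IsProjFlat (F i)) ×
      (∀ p → ¬ F 0 p) ×
      (∀ p → F k p) ×
      (∀ i → i Data.Nat.< k → F i ⊆ F (suc i)) ×
      (∀ p → X p ⇔ ∃ λ i → Even i × i Data.Nat.< k × F (suc i) p × ¬ F i p)

  module Affine (H : PSet) where
    EAG : PSet
    EAG p = ¬ H p

    -- affine flats: flats of the restriction PG(r-1,q)|(E - H),
    -- i.e. subsets of E - H of the form F - H with F a projective flat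
    IsAffFlat : PSet → Set₁
    IsAffFlat Y = (Y ⊆ EAG) × Σ PSet λ F → IsProjFlat F × (∀ p → EAG p → (Y p ⇔ F p))

    IsAffTarget : PSet → Set₁
    IsAffTarget X =
      (X ⊆ EAG) ×
      Σ ℕ λ k → Σ (ℕ → PSet) λ F →
        (∀ i → i Data.Nat.< suc k → IsAffFlat (F i)) ×
        (∀ p → ¬ F 0 p) ×
        (∀ p → F k p ⇔ EAG p) ×
        (∀ i → i Data.Nat.< k → F i ⊆ F (suc i)) ×
        (∀ p → X p ⇔ ∃ λ i → Even i × i Data.Nat.< k × F (suc i) p × ¬ F i p)

{-# OPTIONS --safe #-}

-- Deleting H commutes with all the set operations defining a target, so the
-- chain (F₀ - H, …, F_k - H) of affine flats exhibits G - H as an affine target.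

module Submission where

open import Defs
open import Data.Nat using (ℕ; suc; _<_; _≥_)
open import Data.Product using (∃; _×_; _,_; proj₁; proj₂)
open import Function using (_∘_)
open import Function.Bundles using (_⇔_; mk⇔; Equivalence)
open import Relation.Nullary using (¬_)

module _ (𝔽 : FiniteField) (r : ℕ) where
  open Geometry 𝔽 r

  module _ (H : PSet) where
    open Affine H

    _∖H : PSet → PSet
    (X ∖H) p = X p × EAG p

    ∖H⊆EAG : ∀ X → (X ∖H) ⊆ EAG
    ∖H⊆EAG X p = proj₂

    projFlat∖H-isAffFlat : ∀ {F} → IsProjFlat F → IsAffFlat (F ∖H)
    projFlat∖H-isAffFlat {F} isFlat =
      ∖H⊆EAG F , F , isFlat , λ p p∉H → mk⇔ proj₁ (_, p∉H)

    ∖H-mono : ∀ {X Y} → X ⊆ Y → (X ∖H) ⊆ (Y ∖H)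
    ∖H-mono X⊆Y p (x , p∉H) = X⊆Y p x , p∉H

    difference-∖H : ∀ X Y p → EAG p →
                    (X p × ¬ Y p) ⇔ ((X ∖H) p × ¬ (Y ∖H) p)
    difference-∖H X Y p p∉H =
      mk⇔ (λ (x , ¬y) → (x , p∉H) , λ y → ¬y (proj₁ y))
          (λ (x , ¬y) → proj₁ x , λ y → ¬y (y , p∉H))

    projTarget∖H-isAffTarget : ∀ {X} → IsProjTarget X → IsAffTarget (X ∖H)
    projTarget∖H-isAffTarget {X} (k , F , flat , F₀-empty , F_k-full , nested , X≡layers) =
      ∖H⊆EAG X , k , (λ i → F i ∖H) ,
      (λ i i≤k → projFlat∖H-isAffFlat (flat i i≤k)) ,
      (λ p → F₀-empty p ∘ proj₁) ,
      (λ p → mk⇔ proj₂ (F_k-full p ,_)) ,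
      (λ i i<k → ∖H-mono (nested i i<k)) ,
      λ p → mk⇔ (layers-∖H p) (layers-∖H⁻¹ p)
      where
      LayersOf : (ℕ → PSet) → PSet
      LayersOf E p = ∃ λ i → Even i × i < k × E (suc i) p × ¬ E i p

      layers-∖H : ∀ p → (X ∖H) p → LayersOf (λ i → F i ∖H) p
      layers-∖H p (x , p∉H) =
        let i , even , i<k , layer = X≡layers p .Equivalence.to x
        in  i , even , i<k , difference-∖H (F (suc i)) (F i) p p∉H .Equivalence.to layer

      layers-∖H⁻¹ : ∀ p → LayersOf (λ i → F i ∖H) p → (X ∖H) p
      layers-∖H⁻¹ p (i , even , i<k , layer@((_ , p∉H) , _)) =
        X≡layers p .Equivalence.from
          (i , even , i<k , difference-∖H (F (suc i)) (F i) p p∉H .Equivalence.from layer) ,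
        p∉H

proposition4p8 : (𝔽 : FiniteField) (r : ℕ) → r ≥ 1 →
    let open Geometry 𝔽 r in
    (G R : PSet) → Is2Coloring G R →
    IsProjTarget G →
    (H : PSet) → IsHyperplane H →
    Affine.IsAffTarget H (λ p → G p × ¬ H p)
proposition4p8 𝔽 r _ G _ _ G-target H _ = projTarget∖H-isAffTarget 𝔽 r H G-target
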